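{- The following two statements are equivalent. (A) For every positive integer $n$ and every system $T\subseteq\{x_i+1=x_k,\ x_i\cdot x_j=x_k:\ i,j,k\in\{1,\ldots,n\}\}$ which has only finitely many solutions in positive integers $x_1,\ldots,x_n$, each such solution satisfies $x_1,\ldots,x_n\leqslant f(n)$. (B) For every positive integer $n$ and all positive integers $x_1,\ldots,x_n$ with $\max(x_1,\ldots,x_n)>f(n)$, there exist positive integers $y_1,\ldots,y_n$ such that $\max(x_1,\ldots,x_n)<\max(y_1,\ldots,y_n)$; for all $i,k\in\{1,\ldots,n\}$, $x_i+1=x_k$ implies $y_i+1=y_k$; and for all $i,j,k\in\{1,\ldots,n\}$, $x_i\cdot x_j=x_k$ implies $y_i\cdot y_j=y_k$.
   Context: Define $f:\mathbb{N}\setminus\{0\}\to\mathbb{N}\setminus\{0\}$ by $f(1)=1$, $f(n)=2^{2^{n-2}}$ for $n\in\{2,3,4,5\}$, and $f(n)=\left(2+2^{2^{n-4}}\right)^{2^{n-4}}$ for $n\geqslant 6$. -}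

module Defs where

open import Data.Nat using (ℕ; zero; suc; _+_; _*_; _∸_; _^_; _≤_; _<_; _⊔_)
open import Data.Fin using (Fin)
open import Data.Vec using (Vec; lookup; foldr)
open import Data.List using (List)
open import Data.List.Relation.Unary.All using (All)
open import Data.List.Membership.Propositional using (_∈_)
open import Data.Product using (Σ; ∃-syntax; _×_)
open import Relation.Binary.PropositionalEquality using (_≡_)
open import Relation.Nullary using (¬_)

-- The function f.  f 0 is a junk value (never used: n ≥ 1 everywhere).
f : ℕ → ℕ
f 0 = 1
f 1 = 1
f 2 = 2 ^ (2 ^ 0)
f 3 = 2 ^ (2 ^ 1)
f 4 = 2 ^ (2 ^ 2)
f 5 = 2 ^ (2 ^ 3)
f n@(suc (suc (suc (suc (suc (suc _)))))) = (2 + 2 ^ (2 ^ (n ∸ 4))) ^ (2 ^ (n ∸ 4))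

-- Equations in the variables x_0 … x_{n-1} (Fin n indexes {1,…,n}).
data Eqn (n : ℕ) : Set where
  add : Fin n → Fin n → Eqn n
  mul : Fin n → Fin n → Fin n → Eqn n

Holds : ∀ {n} → Vec ℕ n → Eqn n → Set
Holds x (add i k)   = lookup x i + 1 ≡ lookup x k
Holds x (mul i j k) = lookup x i * lookup x j ≡ lookup x k

Positive : ∀ {n} → Vec ℕ n → Set
Positive {n} x = (i : Fin n) → 1 ≤ lookup x i

IsSolution : ∀ {n} → List (Eqn n) → Vec ℕ n → Set
IsSolution T x = Positive x × All (Holds x) T

FinitelyManySolutions : ∀ {n} → List (Eqn n) → Set
FinitelyManySolutions {n} T = ∃[ L ] ((x : Vec ℕ n) → IsSolution T x → x ∈ L)

maxV : ∀ {n} → Vec ℕ n → ℕ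
maxV = foldr _ _⊔_ 0

StatementA : Set
StatementA =
  (n : ℕ) → 1 ≤ n → (T : List (Eqn n)) → FinitelyManySolutions T →
  (x : Vec ℕ n) → IsSolution T x → (i : Fin n) → lookup x i ≤ f n

StatementB : Set
StatementB =
  (n : ℕ) → 1 ≤ n → (x : Vec ℕ n) → Positive x → f n < maxV x →
  ¬ ¬ (∃[ y ] (Positive y × maxV x < maxV y
        × ((i k : Fin n) → lookup x i + 1 ≡ lookup x k → lookup y i + 1 ≡ lookup y k)
        × ((i j k : Fin n) → lookup x i * lookup x j ≡ lookup x k
                           → lookup y i * lookup y j ≡ lookup y k)))

{-# OPTIONS --safe #-}
module Submission where

-- The relation between x and y in (B) says exactly that y solves the system of
-- all equations satisfied by x, and a system has finitely many positive
-- solutions iff their maxima are bounded.  (A) ⇒ (B): if x had no such y, the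
-- system of x would have bounded, hence finitely many, solutions, so (A) would
-- give x ≤ f n.  (B) ⇒ (A): a solution of T above f n could be improved by (B)
-- over and over to solutions of T with ever larger maxima, contradicting
-- finiteness.

open import Defs
open import Level using (0ℓ)
open import Function.Bundles using (_⇔_; mk⇔)
open import Data.Nat using (ℕ; zero; suc; _+_; _*_; _≤_; _<_; _⊔_; _≟_; z≤n; s≤s)
open import Data.Nat.Properties using (≤-trans; <-trans; ≤-<-trans; <-≤-trans; m≤m⊔n; m≤n⊔m; ⊔-lub; ≮⇒≥; <⇒≱)
open import Data.Fin using (Fin; zero; suc)
open import Data.Vec using (Vec; []; _∷_; lookup)
open import Data.List using (List; []; _∷_; _++_; map; filter; allFin; upTo; cartesianProduct; cartesianProductWith)
open import Data.List.Extrema.Nat using (max; xs≤max)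
open import Data.List.Relation.Unary.All as All using (All)
open import Data.List.Relation.Unary.Any using (here)
open import Data.List.Membership.Propositional using (_∈_)
open import Data.List.Membership.Propositional.Properties
  using (∈-++⁺ˡ; ∈-++⁺ʳ; ∈-map⁺; ∈-filter⁺; ∈-filter⁻; ∈-allFin; ∈-upTo⁺; ∈-cartesianProduct⁺; ∈-cartesianProductWith⁺)
open import Data.Product using (∃-syntax; _×_; _,_; proj₁; proj₂)
open import Effect.Monad using (RawMonad)
open import Relation.Binary.PropositionalEquality using (_≡_; refl)
open import Relation.Nullary using (¬_; Dec)
open import Relation.Nullary.Negation using (¬¬-Monad; ¬¬-map)

open RawMonad (¬¬-Monad {0ℓ})

lookup≤maxV : ∀ {n} (x : Vec ℕ n) (i : Fin n) → lookup x i ≤ maxV x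
lookup≤maxV (a ∷ x) zero    = m≤m⊔n a (maxV x)
lookup≤maxV (a ∷ x) (suc i) = ≤-trans (lookup≤maxV x i) (m≤n⊔m a (maxV x))

maxV-lub : ∀ {n} (x : Vec ℕ n) {M : ℕ} → ((i : Fin n) → lookup x i ≤ M) → maxV x ≤ M
maxV-lub []      x≤M = z≤n
maxV-lub (a ∷ x) x≤M = ⊔-lub (x≤M zero) (maxV-lub x (λ i → x≤M (suc i)))

vecsBoundedBy : (M n : ℕ) → List (Vec ℕ n)
vecsBoundedBy M zero    = [] ∷ []
vecsBoundedBy M (suc n) = cartesianProductWith _∷_ (upTo (suc M)) (vecsBoundedBy M n)

∈-vecsBoundedBy : ∀ {n} M (x : Vec ℕ n) → maxV x ≤ M → x ∈ vecsBoundedBy M n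
∈-vecsBoundedBy M []      x≤M = here refl
∈-vecsBoundedBy M (a ∷ x) x≤M =
  ∈-cartesianProductWith⁺ _∷_ (∈-upTo⁺ (s≤s (≤-trans (m≤m⊔n a (maxV x)) x≤M)))
                              (∈-vecsBoundedBy M x (≤-trans (m≤n⊔m a (maxV x)) x≤M))

BoundedSolutions : ∀ {n} → List (Eqn n) → Set
BoundedSolutions T = ∃[ M ] (∀ x → IsSolution T x → maxV x ≤ M)

boundedSolutions⇒finitelyManySolutions : ∀ {n} {T : List (Eqn n)} →
  BoundedSolutions T → FinitelyManySolutions T
boundedSolutions⇒finitelyManySolutions (M , bound) =
  vecsBoundedBy M _ , λ x sol → ∈-vecsBoundedBy M x (bound x sol)

finitelyManySolutions⇒boundedSolutions : ∀ {n} {T : List (Eqn n)} →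
  FinitelyManySolutions T → BoundedSolutions T
finitelyManySolutions⇒boundedSolutions (L , complete) =
  max 0 (map maxV L) , λ x sol → All.lookup (xs≤max 0 (map maxV L)) (∈-map⁺ maxV (complete x sol))

allEqns : (n : ℕ) → List (Eqn n)
allEqns n = cartesianProductWith add (allFin n) (allFin n)
         ++ cartesianProductWith (λ i jk → mul i (proj₁ jk) (proj₂ jk))
                                 (allFin n) (cartesianProduct (allFin n) (allFin n))

∈-allEqns : ∀ {n} (e : Eqn n) → e ∈ allEqns n
∈-allEqns (add i k)   = ∈-++⁺ˡ (∈-cartesianProductWith⁺ add (∈-allFin i) (∈-allFin k))
∈-allEqns {n} (mul i j k) = ∈-++⁺ʳ (cartesianProductWith add (allFin n) (allFin n))
  (∈-cartesianProductWith⁺ (λ i jk → mul i (proj₁ jk) (proj₂ jk)) (∈-allFin i)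
                           (∈-cartesianProduct⁺ (∈-allFin j) (∈-allFin k)))

holds? : ∀ {n} (x : Vec ℕ n) (e : Eqn n) → Dec (Holds x e)
holds? x (add i k)   = lookup x i + 1 ≟ lookup x k
holds? x (mul i j k) = lookup x i * lookup x j ≟ lookup x k

eqnsOf : ∀ {n} → Vec ℕ n → List (Eqn n)
eqnsOf {n} x = filter (holds? x) (allEqns n)

-- Spelled out as in (B), so that (B) reads ¬ ¬ ∃[ y ] (Positive y × maxV x < maxV y × Preserves x y).
Preserves : ∀ {n} → Vec ℕ n → Vec ℕ n → Set
Preserves {n} x y =
    ((i k : Fin n) → lookup x i + 1 ≡ lookup x k → lookup y i + 1 ≡ lookup y k)
  × ((i j k : Fin n) → lookup x i * lookup x j ≡ lookup x k → lookup y i * lookup y j ≡ lookup y k)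

preserves-holds : ∀ {n} {x y : Vec ℕ n} → Preserves x y → (e : Eqn n) → Holds x e → Holds y e
preserves-holds (pres+ , pres*) (add i k)   = pres+ i k
preserves-holds (pres+ , pres*) (mul i j k) = pres* i j k

preserves-isSolution : ∀ {n} {T : List (Eqn n)} {x y : Vec ℕ n} →
  Preserves x y → Positive y → IsSolution T x → IsSolution T y
preserves-isSolution pres posy (_ , holds) = posy , All.map (preserves-holds pres _) holds

isSolution-eqnsOf : ∀ {n} {x : Vec ℕ n} → Positive x → IsSolution (eqnsOf x) x
isSolution-eqnsOf {n} {x} posx =
  posx , All.tabulate (λ e∈ → proj₂ (∈-filter⁻ (holds? x) {xs = allEqns n} e∈))

eqnsOf-preserves : ∀ {n} {x y : Vec ℕ n} → All (Holds y) (eqnsOf x) → Preserves x y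
eqnsOf-preserves {x = x} holds =
    (λ i k eq → All.lookup holds (∈-filter⁺ (holds? x) (∈-allEqns (add i k)) eq))
  , (λ i j k eq → All.lookup holds (∈-filter⁺ (holds? x) (∈-allEqns (mul i j k)) eq))

¬¬-unbounded : {A : Set} {P : A → Set} (m : A → ℕ) →
  (∀ {a} → P a → ¬ ¬ (∃[ b ] (P b × m a < m b))) →
  ∀ {a} → P a → (k : ℕ) → ¬ ¬ (∃[ b ] (P b × k ≤ m b))
¬¬-unbounded m ascend {a} pa zero    = pure (a , pa , z≤n)
¬¬-unbounded m ascend     pa (suc k) = do
  (b , pb , k≤mb) ← ¬¬-unbounded m ascend pa k
  (c , pc , mb<mc) ← ascend pb
  pure (c , pc , ≤-<-trans k≤mb mb<mc)

statementA⇒statementB : StatementA → StatementB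
statementA⇒statementB hA n 1≤n x posx fn<x noAscent =
  <⇒≱ fn<x (maxV-lub x (hA n 1≤n (eqnsOf x) finite x (isSolution-eqnsOf posx)))
  where
  finite : FinitelyManySolutions (eqnsOf x)
  finite = boundedSolutions⇒finitelyManySolutions (maxV x , λ y (posy , holds) →
    ≮⇒≥ (λ x<y → noAscent (y , posy , x<y , eqnsOf-preserves holds)))

statementB⇒statementA : StatementB → StatementA
statementB⇒statementA hB n 1≤n T finite x solx i
  with M , bound ← finitelyManySolutions⇒boundedSolutions finite = ≮⇒≥ λ fn<xi →
  ¬¬-unbounded maxV ascend (solx , <-≤-trans fn<xi (lookup≤maxV x i)) (suc M)
    (λ (y , (soly , _) , M<y) → <⇒≱ M<y (bound y soly))
  where
  ascend : ∀ {z} → IsSolution T z × f n < maxV z →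
           ¬ ¬ (∃[ y ] ((IsSolution T y × f n < maxV y) × maxV z < maxV y))
  ascend {z} (solz@(posz , _) , fn<z) =
    ¬¬-map (λ (y , posy , z<y , pres) → y , (preserves-isSolution pres posy solz , <-trans fn<z z<y) , z<y)
           (hB n 1≤n z posz fn<z)

theorem7 : StatementA ⇔ StatementB
theorem7 = mk⇔ statementA⇒statementB statementB⇒statementA
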